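{- For all terms $s,t$ in the signature $\langle \wedge,\vee,\cdot,{}',1\rangle$, $\mathbf{W}\models s\approx t$ if and only if $\mathbf{R}\models s\approx t$, where $\mathbf{R}$ is the subalgebra of $\mathbf{W}$ consisting of the regular time warps.
   Context: Let $\omega^+=\omega\cup\{\omega\}$ with its natural total order. A time warp is a map $f\colon\omega^+\to\omega^+$ preserving arbitrary joins; equivalently, $f$ is order-preserving, $f(0)=0$ and $f(\omega)=\sup\{f(n)\mid n\in\omega\}$. Let $W$ be the set of time warps and $p$ the predecessor time warp: $p(0)=0$, $p(\omega)=\omega$, $p(m)=m-1$ for $0<m<\omega$. The time warp algebra is $\mathbf{W}=\langle W,\wedge,\vee,\circ,{}',\mathrm{id}\rangle$ with pointwise $\wedge,\vee$, composition $\circ$, identity $\mathrm{id}$, and $f'$ the largest time warp $g$ with $f\circ g\le p$ pointwise. A time warp $f$ is regular if it is eventually constant (there is $m\in\omega$ with $f(n)=f(m)$ for all $n\in\omega$, $n\ge m$) or eventually linear (there are $m\in\omega$, $k\in\mathbb{Z}$ with $f(n)=n+k$ for all $n\in\omega$, $n\ge m$); the regular time warps form a subalgebra $\mathbf{R}$ of $\mathbf{W}$. Terms are built from variables using $\wedge,\vee,\cdot,{}',1$; an algebra $\mathbf{L}$ satisfies $s\approx t$ if $h(s)=h(t)$ for every homomorphism $h$ from the term algebra to $\mathbf{L}$. -}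

module Defs where

open import Data.Nat using (ℕ; zero; suc) renaming (_≤_ to _≤ℕ_)
open import Data.Integer using (ℤ; +_) renaming (_+_ to _+ℤ_)
open import Data.Product using (Σ; _×_)
open import Data.Sum using (_⊎_)
open import Relation.Binary.PropositionalEquality using (_≡_)

data ω⁺ : Set where
  fin : ℕ → ω⁺
  ω   : ω⁺

data _≤⁺_ : ω⁺ → ω⁺ → Set where
  fin≤fin : ∀ {m n} → m ≤ℕ n → fin m ≤⁺ fin n
  _≤ω     : ∀ x → x ≤⁺ ω

min⁺ : ω⁺ → ω⁺ → ω⁺
min⁺ (fin m) (fin n) = fin (m Data.Nat.⊓ n)
min⁺ (fin m) ω       = fin m
min⁺ ω       y       = y

max⁺ : ω⁺ → ω⁺ → ω⁺
max⁺ (fin m) (fin n) = fin (m Data.Nat.⊔ n)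
max⁺ (fin m) ω       = ω
max⁺ ω       y       = ω

Fun : Set
Fun = ω⁺ → ω⁺

record IsTimeWarp (f : Fun) : Set where
  field
    monotone : ∀ {x y} → x ≤⁺ y → f x ≤⁺ f y
    zero↦zero : f (fin 0) ≡ fin 0
    ω-upper  : ∀ n → f (fin n) ≤⁺ f ω
    ω-least  : ∀ u → (∀ n → f (fin n) ≤⁺ u) → f ω ≤⁺ u

p : Fun
p (fin zero)    = fin zero
p (fin (suc m)) = fin m
p ω             = ω

EventuallyConstant : Fun → Set
EventuallyConstant f = Σ ℕ λ m → ∀ n → m ≤ℕ n → f (fin n) ≡ f (fin m)

EventuallyLinear : Fun → Set
EventuallyLinear f = Σ ℕ λ m → Σ ℤ λ k → ∀ n → m ≤ℕ n →
  Σ ℕ λ j → (f (fin n) ≡ fin j) × (+ j ≡ (+ n) +ℤ k)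

IsRegular : Fun → Set
IsRegular f = IsTimeWarp f × (EventuallyConstant f ⊎ EventuallyLinear f)

record IsResidualOp (r : Fun → Fun) : Set where
  field
    tw      : ∀ f → IsTimeWarp f → IsTimeWarp (r f)
    below-p : ∀ f → IsTimeWarp f → ∀ x → f (r f x) ≤⁺ p x
    largest : ∀ f → IsTimeWarp f → ∀ g → IsTimeWarp g →
              (∀ x → f (g x) ≤⁺ p x) → ∀ x → g x ≤⁺ r f x

data Term : Set where
  var  : ℕ → Term
  _∧ₜ_ : Term → Term → Term
  _∨ₜ_ : Term → Term → Term
  _·ₜ_ : Term → Term → Term
  _′ₜ  : Term → Term
  1ₜ   : Term

⟦_⟧ : Term → (Fun → Fun) → (ℕ → Fun) → Fun
⟦ var i ⟧  r a x = a i x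
⟦ s ∧ₜ t ⟧ r a x = min⁺ (⟦ s ⟧ r a x) (⟦ t ⟧ r a x)
⟦ s ∨ₜ t ⟧ r a x = max⁺ (⟦ s ⟧ r a x) (⟦ t ⟧ r a x)
⟦ s ·ₜ t ⟧ r a x = ⟦ s ⟧ r a (⟦ t ⟧ r a x)
⟦ s ′ₜ ⟧   r a x = r (⟦ s ⟧ r a) x
⟦ 1ₜ ⟧     r a x = x

W⊨_≈_[_] : Term → Term → (Fun → Fun) → Set
W⊨ s ≈ t [ r ] = (a : ℕ → Fun) → (∀ i → IsTimeWarp (a i)) →
  ∀ x → ⟦ s ⟧ r a x ≡ ⟦ t ⟧ r a x

-- R ⊨ s ≈ t : R is the subalgebra of regular time warps, so its operations
-- are the restrictions of those of W; assignments range over regular warps.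
R⊨_≈_[_] : Term → Term → (Fun → Fun) → Set
R⊨ s ≈ t [ r ] = (a : ℕ → Fun) → (∀ i → IsRegular (a i)) →
  ∀ x → ⟦ s ⟧ r a x ≡ ⟦ t ⟧ r a x

-- A term evaluated at a point x depends on its variables only through finitely much
-- information: their values on an initial segment [0, N], their values at ω, and whether
-- each of them ever takes the value ω.  This is proved by induction on terms, the residual
-- being handled through the Galois connection  f v ≤ n  ⇔  v ≤ f′(n + 1).  So if an identity
-- fails in W at x, it still fails after replacing each variable by the regular time warp
-- that agrees with it on [0, N], at ω and in finiteness.  The threshold N exists only
-- classically (finiteness of a time warp is undecidable), which suffices because equality
-- in ω⁺ is decidable.
module Submission where

open import Data.Empty using (⊥-elim)
open import Data.Integer using (+_) renaming (_+_ to _+ℤ_; _-_ to _-ℤ_)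
import Data.Integer.Properties as ℤ
open import Data.Integer.Tactic.RingSolver using (solve-∀)
open import Data.Nat using (ℕ; zero; suc; _+_; _∸_; _⊔_; _≤_; _<_; z≤n; z<s; _≤?_; _≟_)
open import Data.Nat.Properties
open import Data.Product using (∃; _×_; _,_; proj₁; proj₂)
open import Data.Product.Function.NonDependent.Propositional using (_×-⇔_)
open import Data.Sum using (_⊎_; inj₁; inj₂; [_,_]′)
open import Data.Sum.Function.Propositional using (_⊎-⇔_)
open import Effect.Monad using (RawMonad)
open import Function using (_∘_)
open import Function.Bundles using (_⇔_; mk⇔; module Equivalence)
open import Function.Construct.Composition using (_⇔-∘_)
open import Function.Construct.Identity using (⇔-id)
open import Function.Construct.Symmetry using (⇔-sym)
open import Function.Related.TypeIsomorphisms using (¬-cong-⇔)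
open import Level using (0ℓ)
open import Relation.Binary.PropositionalEquality
open import Relation.Nullary using (¬_; Dec; yes; no; contradiction)
open import Relation.Nullary.Decidable using (decidable-stable; ¬¬-excluded-middle)
open import Relation.Nullary.Negation using (¬¬-Monad)

open import Defs

open Equivalence using (to; from)
open RawMonad (¬¬-Monad {a = 0ℓ})

variable
  m n c N : ℕ
  x y u : ω⁺
  f g : Fun

≡⇒⇔ : ∀ {A : Set} (P : A → Set) {a b : A} → a ≡ b → P a ⇔ P b
≡⇒⇔ P refl = ⇔-id _

⇔-through : ∀ {A B C D : Set} → A ⇔ C → B ⇔ D → C ⇔ D → A ⇔ B
⇔-through A⇔C B⇔D C⇔D = ⇔-sym B⇔D ⇔-∘ (C⇔D ⇔-∘ A⇔C)

≤⁺-refl : x ≤⁺ x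
≤⁺-refl {fin n} = fin≤fin ≤-refl
≤⁺-refl {ω}     = ω ≤ω

≤⁺-reflexive : x ≡ y → x ≤⁺ y
≤⁺-reflexive refl = ≤⁺-refl

≤⁺-trans : x ≤⁺ y → y ≤⁺ u → x ≤⁺ u
≤⁺-trans (fin≤fin p) (fin≤fin q) = fin≤fin (≤-trans p q)
≤⁺-trans p           (_ ≤ω)      = _ ≤ω

≤⁺-antisym : x ≤⁺ y → y ≤⁺ x → x ≡ y
≤⁺-antisym (fin≤fin p) (fin≤fin q) = cong fin (≤-antisym p q)
≤⁺-antisym (ω ≤ω)      _           = refl

ω≤⁺⇒≡ω : ω ≤⁺ x → x ≡ ω
ω≤⁺⇒≡ω (ω ≤ω) = refl

ω≰⁺fin : ¬ ω ≤⁺ fin n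
ω≰⁺fin ()

ω-upward : x ≤⁺ y → x ≡ ω → y ≡ ω
ω-upward x≤y refl = ω≤⁺⇒≡ω x≤y

0≤⁺ : ∀ x → fin 0 ≤⁺ x
0≤⁺ (fin n) = fin≤fin z≤n
0≤⁺ ω       = _ ≤ω

1+n≰⁺n : ¬ fin (suc n) ≤⁺ fin n
1+n≰⁺n (fin≤fin p) = 1+n≰n p

≰⁺⇒>⁺ : ∀ c → ¬ x ≤⁺ fin c → fin (suc c) ≤⁺ x
≰⁺⇒>⁺ {fin n} c x≰c = fin≤fin (≰⇒> (x≰c ∘ fin≤fin))
≰⁺⇒>⁺ {ω}     c _   = _ ≤ω

≱⁺⇒<⁺ : ∀ c → ¬ fin (suc c) ≤⁺ x → x ≤⁺ fin c
≱⁺⇒<⁺ {fin n} c c<x = fin≤fin (≮⇒≥ (c<x ∘ fin≤fin))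
≱⁺⇒<⁺ {ω}     c c<ω = contradiction (_ ≤ω) c<ω

all-fin≤⁺⇒≡ω : (∀ m → fin m ≤⁺ x) → x ≡ ω
all-fin≤⁺⇒≡ω {fin n} above = contradiction (above (suc n)) 1+n≰⁺n
all-fin≤⁺⇒≡ω {ω}     _     = refl

≢ω⇒fin : x ≢ ω → ∃ λ n → x ≡ fin n
≢ω⇒fin {fin n} _   = n , refl
≢ω⇒fin {ω}     x≢ω = contradiction refl x≢ω

_≤⁺?_ : ∀ x y → Dec (x ≤⁺ y)
fin m ≤⁺? fin n with m ≤? n
... | yes m≤n = yes (fin≤fin m≤n)
... | no  m≰n = no λ { (fin≤fin m≤n) → m≰n m≤n }
x     ≤⁺? ω     = yes (x ≤ω)
ω     ≤⁺? fin n = no λ ()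

≤⁺-stable : ¬ ¬ x ≤⁺ y → x ≤⁺ y
≤⁺-stable = decidable-stable (_ ≤⁺? _)

_≟⁺_ : ∀ (x y : ω⁺) → Dec (x ≡ y)
fin m ≟⁺ fin n with m ≟ n
... | yes refl = yes refl
... | no  m≢n  = no λ { refl → m≢n refl }
fin m ≟⁺ ω     = no λ ()
ω     ≟⁺ fin n = no λ ()
ω     ≟⁺ ω     = yes refl

min⁺≤ˡ : ∀ x y → min⁺ x y ≤⁺ x
min⁺≤ˡ (fin m) (fin n) = fin≤fin (m⊓n≤m m n)
min⁺≤ˡ (fin m) ω       = ≤⁺-refl
min⁺≤ˡ ω       y       = y ≤ω

min⁺≤ʳ : ∀ x y → min⁺ x y ≤⁺ y
min⁺≤ʳ (fin m) (fin n) = fin≤fin (m⊓n≤n m n)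
min⁺≤ʳ (fin m) ω       = _ ≤ω
min⁺≤ʳ ω       y       = ≤⁺-refl

min⁺-glb : u ≤⁺ x → u ≤⁺ y → u ≤⁺ min⁺ x y
min⁺-glb (fin≤fin p) (fin≤fin q) = fin≤fin (⊓-glb p q)
min⁺-glb (fin≤fin p) (_ ≤ω)      = fin≤fin p
min⁺-glb (_ ≤ω)      q           = q

min⁺-mono-≤⁺ : ∀ {x y x′ y′} → x ≤⁺ x′ → y ≤⁺ y′ → min⁺ x y ≤⁺ min⁺ x′ y′
min⁺-mono-≤⁺ {x} {y} x≤x′ y≤y′ = min⁺-glb (≤⁺-trans (min⁺≤ˡ x y) x≤x′) (≤⁺-trans (min⁺≤ʳ x y) y≤y′)

min⁺≡ω⇒ : ∀ x y → min⁺ x y ≡ ω → x ≡ ω × y ≡ ω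
min⁺≡ω⇒ (fin m) (fin n) ()
min⁺≡ω⇒ (fin m) ω       ()
min⁺≡ω⇒ ω       y       y≡ω = refl , y≡ω

≤max⁺ˡ : ∀ x y → x ≤⁺ max⁺ x y
≤max⁺ˡ (fin m) (fin n) = fin≤fin (m≤m⊔n m n)
≤max⁺ˡ (fin m) ω       = _ ≤ω
≤max⁺ˡ ω       y       = ω ≤ω

≤max⁺ʳ : ∀ x y → y ≤⁺ max⁺ x y
≤max⁺ʳ (fin m) (fin n) = fin≤fin (m≤n⊔m m n)
≤max⁺ʳ (fin m) ω       = ω ≤ω
≤max⁺ʳ ω       y       = y ≤ω

max⁺-lub : x ≤⁺ u → y ≤⁺ u → max⁺ x y ≤⁺ u
max⁺-lub (fin≤fin p) (fin≤fin q) = fin≤fin (⊔-lub p q)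
max⁺-lub (_ ≤ω)      _           = _ ≤ω

max⁺-mono-≤⁺ : ∀ {x y x′ y′} → x ≤⁺ x′ → y ≤⁺ y′ → max⁺ x y ≤⁺ max⁺ x′ y′
max⁺-mono-≤⁺ {x′ = x′} {y′} x≤x′ y≤y′ = max⁺-lub (≤⁺-trans x≤x′ (≤max⁺ˡ x′ y′)) (≤⁺-trans y≤y′ (≤max⁺ʳ x′ y′))

max⁺≡ω⇒ : ∀ x y → max⁺ x y ≡ ω → x ≡ ω ⊎ y ≡ ω
max⁺≡ω⇒ (fin m) (fin n) ()
max⁺≡ω⇒ (fin m) ω       _ = inj₂ refl
max⁺≡ω⇒ ω       y       _ = inj₁ refl

open IsTimeWarp

_⊓ᶠ_ _⊔ᶠ_ : Fun → Fun → Fun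
(f ⊓ᶠ g) x = min⁺ (f x) (g x)
(f ⊔ᶠ g) x = max⁺ (f x) (g x)

monotone-ω : IsTimeWarp f → x ≤⁺ y → f x ≡ ω → f y ≡ ω
monotone-ω tf x≤y = ω-upward (monotone tf x≤y)

zero≢ω : IsTimeWarp f → f (fin 0) ≢ ω
zero≢ω tf f0≡ω with () ← trans (sym (zero↦zero tf)) f0≡ω

¬¬-reaches : IsTimeWarp f → fin c ≤⁺ f ω → ¬ ¬ ∃ λ n → fin c ≤⁺ f (fin n)
¬¬-reaches {c = zero}  tf _    never = never (0 , 0≤⁺ _)
¬¬-reaches {c = suc c} tf c<fω never =
  1+n≰⁺n (≤⁺-trans c<fω (ω-least tf (fin c) λ n → ≱⁺⇒<⁺ c λ c<fn → never (n , c<fn)))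

all-fin≤⁺⇒ω≤⁺ : (∀ n → fin n ≤⁺ u) → ω ≤⁺ u
all-fin≤⁺⇒ω≤⁺ above = subst (ω ≤⁺_) (sym (all-fin≤⁺⇒≡ω above)) ≤⁺-refl

isTimeWarp-id : IsTimeWarp (λ x → x)
isTimeWarp-id = record
  { monotone  = λ x≤y → x≤y
  ; zero↦zero = refl
  ; ω-upper   = λ n → _ ≤ω
  ; ω-least   = λ u → all-fin≤⁺⇒ω≤⁺
  }

isTimeWarp-∘ : IsTimeWarp f → IsTimeWarp g → IsTimeWarp (f ∘ g)
isTimeWarp-∘ {f} {g} tf tg = record
  { monotone  = monotone tf ∘ monotone tg
  ; zero↦zero = trans (cong f (zero↦zero tg)) (zero↦zero tf)
  ; ω-upper   = monotone tf ∘ ω-upper tg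
  ; ω-least   = least
  }
  where
  least : ∀ u → (∀ n → f (g (fin n)) ≤⁺ u) → f (g ω) ≤⁺ u
  least u bound = below (g ω) ≤⁺-refl
    where
    below-fin : ∀ c → fin c ≤⁺ g ω → f (fin c) ≤⁺ u
    below-fin c c≤gω = ≤⁺-stable λ fc≰u →
      ¬¬-reaches tg c≤gω λ (n , c≤gn) → fc≰u (≤⁺-trans (monotone tf c≤gn) (bound n))
    below : ∀ y → y ≤⁺ g ω → f y ≤⁺ u
    below (fin c) c≤gω = below-fin c c≤gω
    below ω       ω≤gω = ω-least tf u λ c → below-fin c (≤⁺-trans (fin c ≤ω) ω≤gω)

isTimeWarp-⊓ : IsTimeWarp f → IsTimeWarp g → IsTimeWarp (f ⊓ᶠ g)
isTimeWarp-⊓ {f} {g} tf tg = record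
  { monotone  = λ x≤y → min⁺-mono-≤⁺ (monotone tf x≤y) (monotone tg x≤y)
  ; zero↦zero = cong₂ min⁺ (zero↦zero tf) (zero↦zero tg)
  ; ω-upper   = λ n → min⁺-mono-≤⁺ (ω-upper tf n) (ω-upper tg n)
  ; ω-least   = least
  }
  where
  least : ∀ u → (∀ n → (f ⊓ᶠ g) (fin n) ≤⁺ u) → (f ⊓ᶠ g) ω ≤⁺ u
  least ω       _     = _ ≤ω
  least (fin c) bound = ≤⁺-stable λ min≰c →
    ¬¬-reaches tf (≰⁺⇒>⁺ c (min≰c ∘ ≤⁺-trans (min⁺≤ˡ _ _))) λ (n , c<fn) →
    ¬¬-reaches tg (≰⁺⇒>⁺ c (min≰c ∘ ≤⁺-trans (min⁺≤ʳ _ _))) λ (m , c<gm) →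
    1+n≰⁺n (≤⁺-trans (min⁺-glb (≤⁺-trans c<fn (monotone tf (fin≤fin (m≤m⊔n n m))))
                                (≤⁺-trans c<gm (monotone tg (fin≤fin (m≤n⊔m n m)))))
                      (bound (n ⊔ m)))

isTimeWarp-⊔ : IsTimeWarp f → IsTimeWarp g → IsTimeWarp (f ⊔ᶠ g)
isTimeWarp-⊔ {f} {g} tf tg = record
  { monotone  = λ x≤y → max⁺-mono-≤⁺ (monotone tf x≤y) (monotone tg x≤y)
  ; zero↦zero = cong₂ max⁺ (zero↦zero tf) (zero↦zero tg)
  ; ω-upper   = λ n → max⁺-mono-≤⁺ (ω-upper tf n) (ω-upper tg n)
  ; ω-least   = λ u bound → max⁺-lub (ω-least tf u (λ n → ≤⁺-trans (≤max⁺ˡ _ _) (bound n)))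
                                     (ω-least tg u (λ n → ≤⁺-trans (≤max⁺ʳ _ _) (bound n)))
  }

FiniteValued : Fun → Set
FiniteValued f = ∀ n → f (fin n) ≢ ω

finiteValued-⊓ : IsTimeWarp f → IsTimeWarp g →
                 FiniteValued (f ⊓ᶠ g) ⇔ (¬ (¬ FiniteValued f × ¬ FiniteValued g))
finiteValued-⊓ tf tg = mk⇔
  (λ fv (f-hits , g-hits) → f-hits λ k fk≡ω → g-hits λ l gl≡ω →
     fv (k ⊔ l) (cong₂ min⁺ (monotone-ω tf (fin≤fin (m≤m⊔n k l)) fk≡ω)
                            (monotone-ω tg (fin≤fin (m≤n⊔m k l)) gl≡ω)))
  (λ not-both k min≡ω → not-both ( (λ fv → fv k (proj₁ (min⁺≡ω⇒ _ _ min≡ω)))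
                                 , (λ fv → fv k (proj₂ (min⁺≡ω⇒ _ _ min≡ω)))))

finiteValued-⊔ : FiniteValued (f ⊔ᶠ g) ⇔ (FiniteValued f × FiniteValued g)
finiteValued-⊔ = mk⇔
  (λ fv → (λ k → fv k ∘ ω-upward (≤max⁺ˡ _ _)) , (λ k → fv k ∘ ω-upward (≤max⁺ʳ _ _)))
  (λ (fvf , fvg) k max≡ω → [ fvf k , fvg k ]′ (max⁺≡ω⇒ _ _ max≡ω))

finiteValued-∘ : IsTimeWarp f → IsTimeWarp g →
                 FiniteValued (f ∘ g) ⇔ (f (g ω) ≢ ω ⊎ FiniteValued f × FiniteValued g)
finiteValued-∘ {f} {g} tf tg = mk⇔ split join
  where
  join : f (g ω) ≢ ω ⊎ FiniteValued f × FiniteValued g → FiniteValued (f ∘ g)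
  join (inj₁ fgω≢ω)       k fgk≡ω = fgω≢ω (monotone-ω tf (ω-upper tg k) fgk≡ω)
  join (inj₂ (fvf , fvg)) k fgk≡ω with ≢ω⇒fin (fvg k)
  ... | j , gk≡j = fvf j (subst (λ y → f y ≡ ω) gk≡j fgk≡ω)
  split : FiniteValued (f ∘ g) → f (g ω) ≢ ω ⊎ FiniteValued f × FiniteValued g
  split fv with f (g ω) ≟⁺ ω
  ... | no  fgω≢ω = inj₁ fgω≢ω
  ... | yes fgω≡ω = inj₂ (fvf , fvg)
    where
    fvg : FiniteValued g
    fvg k gk≡ω = fv k (trans (cong f gk≡ω) (monotone-ω tf (g ω ≤ω) fgω≡ω))
    ω-below-gω : ∀ j → f (fin j) ≡ ω → ∃ λ c → fin c ≤⁺ g ω × f (fin c) ≡ ω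
    ω-below-gω j fj≡ω with g ω
    ... | fin c = c , ≤⁺-refl , fgω≡ω
    ... | ω     = j , fin j ≤ω , fj≡ω
    fvf : FiniteValued f
    fvf j fj≡ω with ω-below-gω j fj≡ω
    ... | c , c≤gω , fc≡ω = ¬¬-reaches tg c≤gω λ (n , c≤gn) → fv n (monotone-ω tf c≤gn fc≡ω)

step : ℕ → ω⁺ → Fun
step n v (fin k) with k ≤? n
... | yes _ = fin 0
... | no  _ = v
step n v ω = v

step-≤ : ∀ n v x → step n v x ≤⁺ v
step-≤ n v (fin k) with k ≤? n
... | yes _ = 0≤⁺ v
... | no  _ = ≤⁺-refl
step-≤ n v ω = ≤⁺-refl

step-suc : ∀ n v → step n v (fin (suc n)) ≡ v
step-suc n v with suc n ≤? n
... | yes n<n = contradiction n<n (n≮n n)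
... | no  _   = refl

isTimeWarp-step : ∀ n v → IsTimeWarp (step n v)
isTimeWarp-step n v = record
  { monotone  = mono
  ; zero↦zero = refl
  ; ω-upper   = λ k → step-≤ n v (fin k)
  ; ω-least   = λ u bound → subst (_≤⁺ u) (step-suc n v) (bound (suc n))
  }
  where
  mono : x ≤⁺ y → step n v x ≤⁺ step n v y
  mono (x ≤ω) = step-≤ n v x
  mono (fin≤fin {k} {l} k≤l) with k ≤? n | l ≤? n
  ... | yes _   | _       = 0≤⁺ _
  ... | no  _   | no  _   = ≤⁺-refl
  ... | no  k≰n | yes l≤n = contradiction (≤-trans k≤l l≤n) k≰n

step-below-p : IsTimeWarp f → f x ≤⁺ fin n → ∀ y → f (step n x y) ≤⁺ p y
step-below-p {n = n} tf fx≤n (fin k) with k ≤? n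
... | yes _ = subst (_≤⁺ p (fin k)) (sym (zero↦zero tf)) (0≤⁺ _)
step-below-p {n = n} tf fx≤n (fin (suc k)) | no k≰n = ≤⁺-trans fx≤n (fin≤fin (≤-pred (≰⇒> k≰n)))
step-below-p {n = n} tf fx≤n (fin zero)    | no k≰n = contradiction z≤n k≰n
step-below-p tf fx≤n ω = _ ≤ω

extend : ω⁺ → ω⁺ → ℕ → ω⁺
extend ω       _       _ = ω
extend (fin d) (fin c) _ = fin c
extend (fin d) ω       i = fin (d + i)

extend-mono : ∀ d w {i j} → i ≤ j → extend d w i ≤⁺ extend d w j
extend-mono ω       w       _   = ≤⁺-refl
extend-mono (fin d) (fin c) _   = ≤⁺-refl
extend-mono (fin d) ω       i≤j = fin≤fin (+-monoʳ-≤ d i≤j)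

extend-≥ : ∀ d w i → d ≤⁺ w → d ≤⁺ extend d w i
extend-≥ ω       w       i _   = ≤⁺-refl
extend-≥ (fin d) (fin c) i d≤c = d≤c
extend-≥ (fin d) ω       i _   = fin≤fin (m≤m+n d i)

extend-≤ : ∀ d w i → d ≤⁺ w → extend d w i ≤⁺ w
extend-≤ ω       w       i ω≤w = ω≤w
extend-≤ (fin d) (fin c) i _   = ≤⁺-refl
extend-≤ (fin d) ω       i _   = _ ≤ω

extend-≡ω : ∀ d w i → extend d w i ≡ ω → d ≡ ω
extend-≡ω ω       w       i _ = refl
extend-≡ω (fin d) (fin c) i ()
extend-≡ω (fin d) ω       i ()

extend-least : ∀ d w → d ≤⁺ u → (∀ i → extend d w (suc i) ≤⁺ u) → w ≤⁺ u
extend-least ω       w       ω≤u _     = subst (w ≤⁺_) (sym (ω≤⁺⇒≡ω ω≤u)) (w ≤ω)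
extend-least (fin d) (fin c) _   above = above 0
extend-least (fin d) ω       _   above =
  all-fin≤⁺⇒ω≤⁺ λ k → ≤⁺-trans (fin≤fin (≤-trans (n≤1+n k) (m≤n+m (suc k) d))) (above k)

extend-shape : ∀ d w → (∀ i → extend d w i ≡ extend d w 0) ⊎ (∃ λ e → ∀ i → extend d w i ≡ fin (e + i))
extend-shape ω       w       = inj₁ λ _ → refl
extend-shape (fin d) (fin c) = inj₁ λ _ → refl
extend-shape (fin d) ω       = inj₂ (d , λ _ → refl)

-- f on [0, N], continued from f N towards f ω: constantly if f N = ω or f ω is finite, with slope 1 otherwise.
regularize : ℕ → Fun → Fun
regularize N f (fin n) with n ≤? N
... | yes _ = f (fin n)
... | no  _ = extend (f (fin N)) (f ω) (n ∸ N)
regularize N f ω = f ω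

regularize-≤ : ∀ f → n ≤ N → regularize N f (fin n) ≡ f (fin n)
regularize-≤ {n} {N} f n≤N with n ≤? N
... | yes _   = refl
... | no  n≰N = contradiction n≤N n≰N

regularize-> : ∀ f → N < n → regularize N f (fin n) ≡ extend (f (fin N)) (f ω) (n ∸ N)
regularize-> {N} {n} f N<n with n ≤? N
... | yes n≤N = contradiction n≤N (<⇒≱ N<n)
... | no  _   = refl

regularize-beyond : ∀ f i → regularize N f (fin (N + suc i)) ≡ extend (f (fin N)) (f ω) (suc i)
regularize-beyond {N} f i =
  trans (regularize-> f (m<m+n N z<s)) (cong (extend (f (fin N)) (f ω)) (m+n∸m≡n N (suc i)))

isTimeWarp-regularize : ∀ N → IsTimeWarp f → IsTimeWarp (regularize N f)
isTimeWarp-regularize {f} N tf = record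
  { monotone  = mono
  ; zero↦zero = trans (regularize-≤ f (z≤n {N})) (zero↦zero tf)
  ; ω-upper   = ≤ω-value
  ; ω-least   = λ u bound →
      extend-least (f (fin N)) (f ω) (subst (_≤⁺ u) (regularize-≤ f ≤-refl) (bound N))
                   (λ i → subst (_≤⁺ u) (regularize-beyond f i) (bound (N + suc i)))
  }
  where
  fN≤fω : f (fin N) ≤⁺ f ω
  fN≤fω = ω-upper tf N
  ≤ω-value : ∀ n → regularize N f (fin n) ≤⁺ f ω
  ≤ω-value n with n ≤? N
  ... | yes _ = ω-upper tf n
  ... | no  _ = extend-≤ _ _ (n ∸ N) fN≤fω
  mono : x ≤⁺ y → regularize N f x ≤⁺ regularize N f y
  mono (fin n ≤ω) = ≤ω-value n
  mono (ω ≤ω)     = ≤⁺-refl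
  mono (fin≤fin {k} {l} k≤l) with k ≤? N | l ≤? N
  ... | yes _   | yes _   = monotone tf (fin≤fin k≤l)
  ... | yes k≤N | no  _   = ≤⁺-trans (monotone tf (fin≤fin k≤N)) (extend-≥ _ _ (l ∸ N) fN≤fω)
  ... | no  k≰N | yes l≤N = contradiction (≤-trans k≤l l≤N) k≰N
  ... | no  _   | no  _   = extend-mono _ _ (∸-monoˡ-≤ N k≤l)

linear-offset : ∀ e N n → N ≤ n → + (e + (n ∸ N)) ≡ + n +ℤ (+ e -ℤ + N)
linear-offset e N n N≤n = begin
  + (e + (n ∸ N))      ≡⟨ ℤ.pos-+ e (n ∸ N) ⟩
  + e +ℤ + (n ∸ N)     ≡⟨ cong (+ e +ℤ_) (sym (trans (ℤ.m-n≡m⊖n n N) (ℤ.⊖-≥ N≤n))) ⟩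
  + e +ℤ (+ n -ℤ + N)  ≡⟨ exchange (+ e) (+ n) (+ N) ⟩
  + n +ℤ (+ e -ℤ + N)  ∎
  where
  open ≡-Reasoning
  exchange : ∀ a b c → a +ℤ (b -ℤ c) ≡ b +ℤ (a -ℤ c)
  exchange = solve-∀

regularize-regular : ∀ N f → EventuallyConstant (regularize N f) ⊎ EventuallyLinear (regularize N f)
regularize-regular N f with extend-shape (f (fin N)) (f ω)
... | inj₁ constant = inj₁ (suc N , λ n N<n →
        trans (regularize-> f N<n) (trans (constant (n ∸ N))
          (sym (trans (regularize-> f ≤-refl) (constant (suc N ∸ N))))))
... | inj₂ (e , linear) = inj₂ (suc N , + e -ℤ + N , λ n N<n →
        e + (n ∸ N) , trans (regularize-> f N<n) (linear (n ∸ N)) , linear-offset e N n (<⇒≤ N<n))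

record _≈⟨_⟩_ (f : Fun) (N : ℕ) (g : Fun) : Set where
  field
    agree-≤          : ∀ n → n ≤ N → g (fin n) ≡ f (fin n)
    agree-ω          : g ω ≡ f ω
    agree-finiteness : FiniteValued f ⇔ FiniteValued g

open _≈⟨_⟩_

≈-weaken : ∀ {N N′} → N ≤ N′ → f ≈⟨ N′ ⟩ g → f ≈⟨ N ⟩ g
≈-weaken N≤N′ f≈g = record
  { agree-≤          = λ n n≤N → agree-≤ f≈g n (≤-trans n≤N N≤N′)
  ; agree-ω          = agree-ω f≈g
  ; agree-finiteness = agree-finiteness f≈g
  }

Settled : ℕ → Fun → Set
Settled N f = FiniteValued f ⊎ f (fin N) ≡ ω

settled-mono : ∀ {N N′} → IsTimeWarp f → N ≤ N′ → Settled N f → Settled N′ f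
settled-mono tf N≤N′ (inj₁ fv)   = inj₁ fv
settled-mono tf N≤N′ (inj₂ fN≡ω) = inj₂ (monotone-ω tf (fin≤fin N≤N′) fN≡ω)

¬¬-settled : IsTimeWarp f → ¬ ¬ ∃ λ N → Settled N f
¬¬-settled {f} tf = settle <$> ¬¬-excluded-middle
  where
  settle : Dec (∃ λ k → f (fin k) ≡ ω) → ∃ λ N → Settled N f
  settle (yes (k , fk≡ω)) = k , inj₂ fk≡ω
  settle (no  never-ω)    = 0 , inj₁ λ k fk≡ω → never-ω (k , fk≡ω)

TimeWarps : (ℕ → Fun) → Set
TimeWarps a = ∀ i → IsTimeWarp (a i)

¬¬-settled-below : ∀ {a} → TimeWarps a → ∀ V → ¬ ¬ ∃ λ N → ∀ i → i < V → Settled N (a i)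
¬¬-settled-below ta zero    = pure (0 , λ _ ())
¬¬-settled-below ta (suc V) = do
  (N , settled) ← ¬¬-settled-below ta V
  (M , settledV) ← ¬¬-settled (ta V)
  pure (N ⊔ M , λ i i<1+V → [ (λ i<V → settled-mono (ta i) (m≤m⊔n N M) (settled i i<V))
                             , (λ { refl → settled-mono (ta V) (m≤n⊔m N M) settledV }) ]′
                             (m<1+n⇒m<n∨m≡n i<1+V))

regularize-≈ : Settled N f → f ≈⟨ N ⟩ regularize N f
regularize-≈ {N} {f} settled = record
  { agree-≤          = λ n → regularize-≤ f
  ; agree-ω          = refl
  ; agree-finiteness = mk⇔ forward (backward settled)
  }
  where
  forward : FiniteValued f → FiniteValued (regularize N f)
  forward fv n with n ≤? N
  ... | yes _ = fv n
  ... | no  _ = fv N ∘ extend-≡ω (f (fin N)) (f ω) (n ∸ N)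
  backward : Settled N f → FiniteValued (regularize N f) → FiniteValued f
  backward (inj₁ fv)   _  = fv
  backward (inj₂ fN≡ω) fv = contradiction (trans (regularize-≤ f ≤-refl) fN≡ω) (fv N)

module Residual (r : Fun → Fun) (isResidual : IsResidualOp r) where

  open IsResidualOp isResidual

  residual-galois : IsTimeWarp f → f x ≤⁺ fin n ⇔ x ≤⁺ r f (fin (suc n))
  residual-galois {f} {x} {n} tf = mk⇔
    (λ fx≤n → subst (_≤⁺ r f (fin (suc n))) (step-suc n x)
                (largest f tf (step n x) (isTimeWarp-step n x) (step-below-p tf fx≤n) (fin (suc n))))
    (λ x≤r → ≤⁺-trans (monotone tf x≤r) (below-p f tf (fin (suc n))))

  residual-zero : IsTimeWarp f → r f (fin 0) ≡ fin 0
  residual-zero tf = zero↦zero (tw _ tf)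

  residual-suc≡ω : IsTimeWarp f → r f (fin (suc n)) ≡ ω ⇔ f ω ≤⁺ fin n
  residual-suc≡ω tf = mk⇔
    (λ r≡ω → from (residual-galois tf) (subst (ω ≤⁺_) (sym r≡ω) ≤⁺-refl))
    (λ fω≤n → ω≤⁺⇒≡ω (to (residual-galois tf) fω≤n))

  residual-suc≡fin : IsTimeWarp f →
                     r f (fin (suc n)) ≡ fin m ⇔ (f (fin m) ≤⁺ fin n × ¬ f (fin (suc m)) ≤⁺ fin n)
  residual-suc≡fin {m = m} tf = mk⇔
    (λ r≡m → from (residual-galois tf) (≤⁺-reflexive (sym r≡m))
           , λ fm+1≤n → 1+n≰⁺n (subst (fin (suc m) ≤⁺_) r≡m (to (residual-galois tf) fm+1≤n)))
    (λ (fm≤n , fm+1≰n) → ≤⁺-antisym (≱⁺⇒<⁺ m (fm+1≰n ∘ from (residual-galois tf)))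
                                    (to (residual-galois tf) fm≤n))

  residual-ω≤ : IsTimeWarp f → f (fin (suc m)) ≡ ω → r f ω ≤⁺ fin m
  residual-ω≤ {f} {m} tf fm+1≡ω = ω-least (tw f tf) (fin m) below
    where
    below : ∀ k → r f (fin k) ≤⁺ fin m
    below zero    = subst (_≤⁺ fin m) (sym (residual-zero tf)) (0≤⁺ _)
    below (suc k) = ≱⁺⇒<⁺ m λ m+1≤r →
      ω≰⁺fin (subst (_≤⁺ fin k) fm+1≡ω (from (residual-galois tf) m+1≤r))

  ≤residual-ω : IsTimeWarp f → f (fin m) ≡ fin n → fin m ≤⁺ r f ω
  ≤residual-ω {f} {n = n} tf fm≡n =
    ≤⁺-trans (to (residual-galois tf) (≤⁺-reflexive fm≡n)) (ω-upper (tw f tf) (suc n))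

  residual-ω≡fin : IsTimeWarp f → r f ω ≡ fin m ⇔ (f (fin m) ≢ ω × f (fin (suc m)) ≡ ω)
  residual-ω≡fin {f} {m} tf = mk⇔
    (λ r≡m → fm≢ω r≡m , fm+1≡ω r≡m)
    (λ (fm≢ω , fm+1≡ω) → ≤⁺-antisym (residual-ω≤ tf fm+1≡ω) (≤residual-ω tf (proj₂ (≢ω⇒fin fm≢ω))))
    where
    fm≢ω : ∀ {m} → r f ω ≡ fin m → f (fin m) ≢ ω
    fm≢ω {zero}   r≡m = zero≢ω tf
    fm≢ω {suc m′} r≡m fm≡ω = 1+n≰⁺n (subst (_≤⁺ fin m′) r≡m (residual-ω≤ tf fm≡ω))
    fm+1≡ω : r f ω ≡ fin m → f (fin (suc m)) ≡ ω
    fm+1≡ω r≡m with f (fin (suc m)) in fm+1≡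
    ... | ω     = refl
    ... | fin j = contradiction (subst (fin (suc m) ≤⁺_) r≡m (≤residual-ω tf fm+1≡)) 1+n≰⁺n

  residual-ω≡ω : IsTimeWarp f → r f ω ≡ ω ⇔ FiniteValued f
  residual-ω≡ω tf = mk⇔
    (λ { r≡ω zero    → zero≢ω tf
       ; r≡ω (suc m) → ω≰⁺fin ∘ subst (_≤⁺ fin m) r≡ω ∘ residual-ω≤ tf })
    (λ fv → all-fin≤⁺⇒≡ω λ m → ≤residual-ω tf (proj₂ (≢ω⇒fin (fv m))))

  finiteValued-residual : IsTimeWarp f → FiniteValued (r f) ⇔ f ω ≡ ω
  finiteValued-residual {f} tf = mk⇔ forward backward
    where
    forward : FiniteValued (r f) → f ω ≡ ω
    forward fv with f ω in fω≡
    ... | ω     = refl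
    ... | fin c = contradiction (from (residual-suc≡ω tf) (≤⁺-reflexive fω≡)) (fv (suc c))
    backward : f ω ≡ ω → FiniteValued (r f)
    backward fω≡ω zero    = zero≢ω (tw f tf)
    backward fω≡ω (suc n) = ω≰⁺fin ∘ subst (_≤⁺ fin n) fω≡ω ∘ to (residual-suc≡ω tf)

  residual-≡fin-transfer : IsTimeWarp f → IsTimeWarp g →
                           g (fin m) ≡ f (fin m) → g (fin (suc m)) ≡ f (fin (suc m)) →
                           ∀ x → r f x ≡ fin m → r g x ≡ fin m
  residual-≡fin-transfer tf tg _ _ (fin zero) rf0≡m =
    trans (residual-zero tg) (trans (sym (residual-zero tf)) rf0≡m)
  residual-≡fin-transfer tf tg gm≡ gm+1≡ (fin (suc k)) rf≡m =
    from (residual-suc≡fin tg)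
      (subst₂ (λ y z → y ≤⁺ fin k × ¬ z ≤⁺ fin k) (sym gm≡) (sym gm+1≡) (to (residual-suc≡fin tf) rf≡m))
  residual-≡fin-transfer tf tg gm≡ gm+1≡ ω rf≡m =
    from (residual-ω≡fin tg)
      (subst₂ (λ y z → y ≢ ω × z ≡ ω) (sym gm≡) (sym gm+1≡) (to (residual-ω≡fin tf) rf≡m))

  residual-≡ω-transfer : IsTimeWarp f → IsTimeWarp g → g ω ≡ f ω → (FiniteValued f → FiniteValued g) →
                         ∀ x → r f x ≡ ω → r g x ≡ ω
  residual-≡ω-transfer tf tg _ _ (fin zero) = ⊥-elim ∘ zero≢ω (tw _ tf)
  residual-≡ω-transfer tf tg gω≡ _ (fin (suc k)) rf≡ω =
    from (residual-suc≡ω tg) (subst (_≤⁺ fin k) (sym gω≡) (to (residual-suc≡ω tf) rf≡ω))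
  residual-≡ω-transfer tf tg _ fv⇒fv ω rf≡ω =
    from (residual-ω≡ω tg) (fv⇒fv (to (residual-ω≡ω tf) rf≡ω))

varBound : Term → ℕ
varBound (var i)  = suc i
varBound (s ∧ₜ t) = varBound s ⊔ varBound t
varBound (s ∨ₜ t) = varBound s ⊔ varBound t
varBound (s ·ₜ t) = varBound s ⊔ varBound t
varBound (s ′ₜ)   = varBound s
varBound 1ₜ       = 0

module Locality (r : Fun → Fun) (isResidual : IsResidualOp r) where

  open Residual r isResidual
  open IsResidualOp isResidual using (tw)

  isTimeWarp-⟦⟧ : ∀ t {a} → TimeWarps a → IsTimeWarp (⟦ t ⟧ r a)
  isTimeWarp-⟦⟧ (var i)  ta = ta i
  isTimeWarp-⟦⟧ (s ∧ₜ t) ta = isTimeWarp-⊓ (isTimeWarp-⟦⟧ s ta) (isTimeWarp-⟦⟧ t ta)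
  isTimeWarp-⟦⟧ (s ∨ₜ t) ta = isTimeWarp-⊔ (isTimeWarp-⟦⟧ s ta) (isTimeWarp-⟦⟧ t ta)
  isTimeWarp-⟦⟧ (s ·ₜ t) ta = isTimeWarp-∘ (isTimeWarp-⟦⟧ s ta) (isTimeWarp-⟦⟧ t ta)
  isTimeWarp-⟦⟧ (s ′ₜ)   ta = tw _ (isTimeWarp-⟦⟧ s ta)
  isTimeWarp-⟦⟧ 1ₜ       ta = isTimeWarp-id

  module _ {V : ℕ} {a : ℕ → Fun} (ta : TimeWarps a) where

    Near : ℕ → (ℕ → Fun) → Set
    Near N b = ∀ i → i < V → a i ≈⟨ N ⟩ b i

    Robust : ((ℕ → Fun) → Set) → Set
    Robust P = ∃ λ N → ∀ b → TimeWarps b → Near N b → P b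

    robust-zip : ∀ {P Q} → ¬ ¬ Robust P → ¬ ¬ Robust Q → ¬ ¬ Robust (λ b → P b × Q b)
    robust-zip robustP robustQ = do
      (N , P-near) ← robustP
      (M , Q-near) ← robustQ
      pure (N ⊔ M , λ b tb near →
        P-near b tb (λ i i<V → ≈-weaken (m≤m⊔n N M) (near i i<V)) ,
        Q-near b tb (λ i i<V → ≈-weaken (m≤n⊔m N M) (near i i<V)))

    robust-map : ∀ {P Q : (ℕ → Fun) → Set} → (∀ {b} → TimeWarps b → P b → Q b) →
                 ¬ ¬ Robust P → ¬ ¬ Robust Q
    robust-map P⇒Q robustP = do
      (N , P-near) ← robustP
      pure (N , λ b tb near → P⇒Q tb (P-near b tb near))

    ValueRobust : Term → ω⁺ → Set
    ValueRobust t x = Robust (λ b → ⟦ t ⟧ r b x ≡ ⟦ t ⟧ r a x)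

    FinitenessRobust : Term → Set
    FinitenessRobust t = Robust (λ b → FiniteValued (⟦ t ⟧ r a) ⇔ FiniteValued (⟦ t ⟧ r b))

    robust-value      : ∀ t → varBound t ≤ V → ∀ x → ¬ ¬ ValueRobust t x
    robust-finiteness : ∀ t → varBound t ≤ V → ¬ ¬ FinitenessRobust t

    robust-value (var i) i<V (fin n) = pure (n , λ b tb near → agree-≤ (near i i<V) n ≤-refl)
    robust-value (var i) i<V ω       = pure (0 , λ b tb near → agree-ω (near i i<V))
    robust-value (s ∧ₜ t) bound x =
      robust-map (λ _ (s≡ , t≡) → cong₂ min⁺ s≡ t≡)
        (robust-zip (robust-value s (m⊔n≤o⇒m≤o _ _ bound) x) (robust-value t (m⊔n≤o⇒n≤o _ _ bound) x))
    robust-value (s ∨ₜ t) bound x =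
      robust-map (λ _ (s≡ , t≡) → cong₂ max⁺ s≡ t≡)
        (robust-zip (robust-value s (m⊔n≤o⇒m≤o _ _ bound) x) (robust-value t (m⊔n≤o⇒n≤o _ _ bound) x))
    robust-value (s ·ₜ t) bound x =
      robust-map (λ {b} _ (t≡ , s≡) → trans (cong (⟦ s ⟧ r b) t≡) s≡)
        (robust-zip (robust-value t (m⊔n≤o⇒n≤o _ _ bound) x)
                    (robust-value s (m⊔n≤o⇒m≤o _ _ bound) (⟦ t ⟧ r a x)))
    robust-value (s ′ₜ) bound x = by-value (r (⟦ s ⟧ r a) x) refl
      where
      tsa : IsTimeWarp (⟦ s ⟧ r a)
      tsa = isTimeWarp-⟦⟧ s ta
      by-value : ∀ y → r (⟦ s ⟧ r a) x ≡ y → ¬ ¬ ValueRobust (s ′ₜ) x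
      by-value (fin m) rs≡m =
        robust-map (λ tb (sm≡ , sm+1≡) →
                      trans (residual-≡fin-transfer tsa (isTimeWarp-⟦⟧ s tb) sm≡ sm+1≡ x rs≡m) (sym rs≡m))
          (robust-zip (robust-value s bound (fin m)) (robust-value s bound (fin (suc m))))
      by-value ω rs≡ω =
        robust-map (λ tb (sω≡ , fin⇔) →
                      trans (residual-≡ω-transfer tsa (isTimeWarp-⟦⟧ s tb) sω≡ (to fin⇔) x rs≡ω) (sym rs≡ω))
          (robust-zip (robust-value s bound ω) (robust-finiteness s bound))
    robust-value 1ₜ bound x = pure (0 , λ _ _ _ → refl)

    robust-finiteness (var i) i<V = pure (0 , λ b tb near → agree-finiteness (near i i<V))
    robust-finiteness (s ∧ₜ t) bound =
      robust-map (λ tb (s⇔ , t⇔) →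
                    ⇔-through (finiteValued-⊓ (isTimeWarp-⟦⟧ s ta) (isTimeWarp-⟦⟧ t ta))
                              (finiteValued-⊓ (isTimeWarp-⟦⟧ s tb) (isTimeWarp-⟦⟧ t tb))
                              (¬-cong-⇔ (¬-cong-⇔ s⇔ ×-⇔ ¬-cong-⇔ t⇔)))
        (robust-zip (robust-finiteness s (m⊔n≤o⇒m≤o _ _ bound)) (robust-finiteness t (m⊔n≤o⇒n≤o _ _ bound)))
    robust-finiteness (s ∨ₜ t) bound =
      robust-map (λ {b} _ (s⇔ , t⇔) →
                    ⇔-through (finiteValued-⊔ {⟦ s ⟧ r a} {⟦ t ⟧ r a}) (finiteValued-⊔ {⟦ s ⟧ r b} {⟦ t ⟧ r b})
                              (s⇔ ×-⇔ t⇔))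
        (robust-zip (robust-finiteness s (m⊔n≤o⇒m≤o _ _ bound)) (robust-finiteness t (m⊔n≤o⇒n≤o _ _ bound)))
    robust-finiteness (s ·ₜ t) bound =
      robust-map (λ {b} tb ((tω≡ , stω≡) , (s⇔ , t⇔)) →
                    ⇔-through (finiteValued-∘ (isTimeWarp-⟦⟧ s ta) (isTimeWarp-⟦⟧ t ta))
                              (finiteValued-∘ (isTimeWarp-⟦⟧ s tb) (isTimeWarp-⟦⟧ t tb))
                              (≡⇒⇔ (_≢ ω) (sym (trans (cong (⟦ s ⟧ r b) tω≡) stω≡)) ⊎-⇔ (s⇔ ×-⇔ t⇔)))
        (robust-zip (robust-zip (robust-value t bound-t ω) (robust-value s bound-s (⟦ t ⟧ r a ω)))
                    (robust-zip (robust-finiteness s bound-s) (robust-finiteness t bound-t)))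
      where
      bound-s : varBound s ≤ V
      bound-s = m⊔n≤o⇒m≤o _ _ bound
      bound-t : varBound t ≤ V
      bound-t = m⊔n≤o⇒n≤o _ _ bound
    robust-finiteness (s ′ₜ) bound =
      robust-map (λ tb sω≡ → ⇔-through (finiteValued-residual (isTimeWarp-⟦⟧ s ta))
                                        (finiteValued-residual (isTimeWarp-⟦⟧ s tb))
                                        (≡⇒⇔ (_≡ ω) (sym sω≡)))
        (robust-value s bound ω)
    robust-finiteness 1ₜ bound = pure (0 , λ _ _ _ → ⇔-id _)

    robust⇒regularized : ∀ {P} → ¬ ¬ Robust P → ¬ ¬ ∃ λ N → P (λ i → regularize N (a i))
    robust⇒regularized robustP = do
      (N , P-near) ← robustP
      (M , settled) ← ¬¬-settled-below ta V
      pure (N ⊔ M , P-near _ (λ i → isTimeWarp-regularize (N ⊔ M) (ta i)) λ i i<V →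
        ≈-weaken (m≤m⊔n N M) (regularize-≈ (settled-mono (ta i) (m≤n⊔m N M) (settled i i<V))))

  R⊨⇒W⊨ : ∀ s t → R⊨ s ≈ t [ r ] → W⊨ s ≈ t [ r ]
  R⊨⇒W⊨ s t R⊨s≈t a ta x = decidable-stable (_ ≟⁺ _) do
    (N , s≡ , t≡) ← robust⇒regularized ta
                      (robust-zip ta (robust-value ta s (m≤m⊔n _ _) x) (robust-value ta t (m≤n⊔m _ _) x))
    pure (trans (sym s≡) (trans (R⊨s≈t _ (λ i → isTimeWarp-regularize N (ta i) , regularize-regular N (a i)) x) t≡))

theorem3p11 : (r : Fun → Fun) → IsResidualOp r → (s t : Term) →
    ((W⊨ s ≈ t [ r ]) → (R⊨ s ≈ t [ r ])) × ((R⊨ s ≈ t [ r ]) → (W⊨ s ≈ t [ r ]))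
theorem3p11 r isResidual s t = (λ W⊨s≈t a regular → W⊨s≈t a (proj₁ ∘ regular)) , R⊨⇒W⊨ s t
  where open Locality r isResidual
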